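{- Let $n\ge0$ and $0\le i<3^n$. If $C_n(i)=1$, then $(C_{n+1}(3i),C_{n+1}(3i+1),C_{n+1}(3i+2))=(1,3,1)$.
   Context: The unit weight-$3$ Stern–Brocot sequences $SB_n$ ($n\ge0$): $SB_0=(\frac{0}{1},\frac{1}{1})$, and $SB_{n+1}$ is obtained from $SB_n$ by keeping all its terms in order and inserting, between each pair of consecutive terms $\frac{p}{q},\frac{r}{s}$ (in lowest terms, positive denominators), the two fractions $\frac{2p+r}{2q+s}$ and $\frac{p+2r}{q+2s}$, each reduced to lowest terms, in this order. $SB_n$ has $3^n+1$ terms, indexed from $0$. For $0\le i<3^n$, $C_n(i)=qr-ps$ where $\frac{p}{q}$ and $\frac{r}{s}$ are the $i$-th and $(i+1)$-th terms of $SB_n$ in lowest terms with positive denominators. -}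

module Defs where

open import Data.Nat using (ℕ; zero; suc; _+_; _*_; _/_)
open import Data.Nat.GCD using (gcd)
open import Data.Integer as ℤ using (ℤ; +_; _-_)
open import Data.Product using (_×_; _,_)
open import Data.List using (List; []; _∷_; lookup)
open import Data.Maybe using (Maybe; just; nothing)

-- A fraction p/q is represented as a pair (p , q) of natural numbers
-- (all terms of SB_n lie in [0,1], so numerators are nonnegative;
-- denominators are positive).
Frac : Set
Frac = ℕ × ℕ

-- Reduce to lowest terms: divide by gcd.  (The gcd = 0 branch only occurs
-- for (0 , 0), which never arises since denominators are positive.)
reduce : Frac → Frac
reduce (a , b) with gcd a b
... | zero  = (a , b)
... | suc g = (a / suc g , b / suc g)

left right : Frac → Frac → Frac
left  (p , q) (r , s) = reduce (2 * p + r , 2 * q + s)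
right (p , q) (r , s) = reduce (p + 2 * r , q + 2 * s)

step : List Frac → List Frac
step []           = []
step (x ∷ [])     = x ∷ []
step (x ∷ y ∷ xs) = x ∷ left x y ∷ right x y ∷ step (y ∷ xs)

SB : ℕ → List Frac
SB zero    = (0 , 1) ∷ (1 , 1) ∷ []
SB (suc n) = step (SB n)

nth : List Frac → ℕ → Maybe Frac
nth []       _       = nothing
nth (x ∷ xs) zero    = just x
nth (x ∷ xs) (suc i) = nth xs i

C : ℕ → ℕ → Maybe ℤ
C n i with nth (SB n) i | nth (SB n) (suc i)
... | just (p , q) | just (r , s) = just ((+ (q * r)) - (+ (p * s)))
... | _            | _            = nothing

{-# OPTIONS --safe #-}
-- Write det (p/q) (r/s) = qr − ps.  The determinant is bilinear, so against
-- the unreduced inserted fractions (2p+r)/(2q+s) and (p+2r)/(q+2s) the three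
-- new consecutive determinants are det, 3·det and det.  When det = 1, the
-- first and last of these are Bézout identities showing that the inserted
-- fractions are already in lowest terms, so reduction leaves them unchanged.
module Submission where

open import Defs
open import Data.Nat using (ℕ; suc; _<_; _^_; _*_; _+_)
open import Data.Integer using (ℤ; +_)
open import Data.Maybe using (just)
open import Relation.Binary.PropositionalEquality using (_≡_)
open import Data.Product using (_×_)

open import Data.Nat using (zero)
import Data.Nat.Properties as ℕ
open import Data.Nat.Coprimality as Coprimality using (Coprime; coprime⇒gcd≡1)
open import Data.Nat.Divisibility using (_∣_; ∣1⇒≡1; ∣m+n∣m⇒∣n; ∣n⇒∣m*n)
open import Data.Nat.DivMod using (n/1≡n)
import Data.Integer as ℤ
import Data.Integer.Properties as ℤ
open import Data.Integer.Solver using (module +-*-Solver)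
open import Data.List using ([]; _∷_)
open import Data.Product using (∃₂; _,_)
open import Relation.Binary.PropositionalEquality
  using (refl; trans; cong; cong₂; subst; module ≡-Reasoning)

open ≡-Reasoning

det : Frac → Frac → ℤ
det (p , q) (r , s) = + (q * r) ℤ.- + (p * s)

leftᵘ rightᵘ : Frac → Frac → Frac
leftᵘ  (p , q) (r , s) = (2 * p + r , 2 * q + s)
rightᵘ (p , q) (r , s) = (p + 2 * r , q + 2 * s)

m-n≡k⇒m≡n+k : ∀ {m n k} → + m ℤ.- + n ≡ + k → m ≡ n + k
m-n≡k⇒m≡n+k {m} {n} {k} eq = ℤ.+-injective (begin
  + m                    ≡⟨ solve 2 (λ m n → m := n :+ (m :- n)) refl (+ m) (+ n) ⟩
  + n ℤ.+ (+ m ℤ.- + n)  ≡⟨ cong (ℤ._+_ (+ n)) eq ⟩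
  + n ℤ.+ + k            ≡⟨ ℤ.pos-+ n k ⟨
  + (n + k)              ∎)
  where open +-*-Solver

bézout⇒coprime : ∀ {a b} x y → x * a ≡ y * b + 1 → Coprime a b
bézout⇒coprime x y eq {d} (d∣a , d∣b) =
  ∣1⇒≡1 (∣m+n∣m⇒∣n (subst (d ∣_) eq (∣n⇒∣m*n x d∣a)) (∣n⇒∣m*n y d∣b))

reduce-coprime : ∀ {a b} → Coprime a b → reduce (a , b) ≡ (a , b)
reduce-coprime {a} {b} a⊥b rewrite coprime⇒gcd≡1 a⊥b = cong₂ _,_ (n/1≡n a) (n/1≡n b)

det≡1⇒coprimeˡ : ∀ {p q} y → det (p , q) y ≡ + 1 → Coprime p q
det≡1⇒coprimeˡ {p} {q} (r , s) eq = Coprimality.sym (bézout⇒coprime r s (begin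
  r * q      ≡⟨ ℕ.*-comm r q ⟩
  q * r      ≡⟨ m-n≡k⇒m≡n+k eq ⟩
  p * s + 1  ≡⟨ cong (_+ 1) (ℕ.*-comm p s) ⟩
  s * p + 1  ∎))

det≡1⇒coprimeʳ : ∀ x {r s} → det x (r , s) ≡ + 1 → Coprime r s
det≡1⇒coprimeʳ (p , q) eq = bézout⇒coprime q p (m-n≡k⇒m≡n+k eq)

det-cast : ∀ p q r s → det (p , q) (r , s) ≡ + q ℤ.* + r ℤ.- + p ℤ.* + s
det-cast p q r s = cong₂ ℤ._-_ (ℤ.pos-* q r) (ℤ.pos-* p s)

pos-km+n : ∀ k m n → + (k * m + n) ≡ + k ℤ.* + m ℤ.+ + n
pos-km+n k m n = trans (ℤ.pos-+ (k * m) n) (cong (ℤ._+ + n) (ℤ.pos-* k m))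

pos-m+kn : ∀ k m n → + (m + k * n) ≡ + m ℤ.+ + k ℤ.* + n
pos-m+kn k m n = trans (ℤ.pos-+ m (k * n)) (cong (ℤ._+_ (+ m)) (ℤ.pos-* k n))

module _ (p q r s : ℕ) where
  open +-*-Solver

  private
    P Q R S : ℤ
    P = + p; Q = + q; R = + r; S = + s

  det-leftᵘ : det (p , q) (leftᵘ (p , q) (r , s)) ≡ det (p , q) (r , s)
  det-leftᵘ = begin
    det (p , q) (2 * p + r , 2 * q + s)
      ≡⟨ det-cast p q (2 * p + r) (2 * q + s) ⟩
    Q ℤ.* + (2 * p + r) ℤ.- P ℤ.* + (2 * q + s)
      ≡⟨ cong₂ (λ a b → Q ℤ.* a ℤ.- P ℤ.* b) (pos-km+n 2 p r) (pos-km+n 2 q s) ⟩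
    Q ℤ.* (+ 2 ℤ.* P ℤ.+ R) ℤ.- P ℤ.* (+ 2 ℤ.* Q ℤ.+ S)
      ≡⟨ solve 4 (λ P Q R S → Q :* (con (+ 2) :* P :+ R) :- P :* (con (+ 2) :* Q :+ S)
                            := Q :* R :- P :* S) refl P Q R S ⟩
    Q ℤ.* R ℤ.- P ℤ.* S
      ≡⟨ det-cast p q r s ⟨
    det (p , q) (r , s) ∎

  det-rightᵘ : det (rightᵘ (p , q) (r , s)) (r , s) ≡ det (p , q) (r , s)
  det-rightᵘ = begin
    det (p + 2 * r , q + 2 * s) (r , s)
      ≡⟨ det-cast (p + 2 * r) (q + 2 * s) r s ⟩
    + (q + 2 * s) ℤ.* R ℤ.- + (p + 2 * r) ℤ.* S
      ≡⟨ cong₂ (λ a b → a ℤ.* R ℤ.- b ℤ.* S) (pos-m+kn 2 q s) (pos-m+kn 2 p r) ⟩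
    (Q ℤ.+ + 2 ℤ.* S) ℤ.* R ℤ.- (P ℤ.+ + 2 ℤ.* R) ℤ.* S
      ≡⟨ solve 4 (λ P Q R S → (Q :+ con (+ 2) :* S) :* R :- (P :+ con (+ 2) :* R) :* S
                            := Q :* R :- P :* S) refl P Q R S ⟩
    Q ℤ.* R ℤ.- P ℤ.* S
      ≡⟨ det-cast p q r s ⟨
    det (p , q) (r , s) ∎

  det-leftᵘ-rightᵘ : det (leftᵘ (p , q) (r , s)) (rightᵘ (p , q) (r , s)) ≡ + 3 ℤ.* det (p , q) (r , s)
  det-leftᵘ-rightᵘ = begin
    det (2 * p + r , 2 * q + s) (p + 2 * r , q + 2 * s)
      ≡⟨ det-cast (2 * p + r) (2 * q + s) (p + 2 * r) (q + 2 * s) ⟩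
    + (2 * q + s) ℤ.* + (p + 2 * r) ℤ.- + (2 * p + r) ℤ.* + (q + 2 * s)
      ≡⟨ cong₂ ℤ._-_ (cong₂ ℤ._*_ (pos-km+n 2 q s) (pos-m+kn 2 p r))
                     (cong₂ ℤ._*_ (pos-km+n 2 p r) (pos-m+kn 2 q s)) ⟩
    (+ 2 ℤ.* Q ℤ.+ S) ℤ.* (P ℤ.+ + 2 ℤ.* R) ℤ.- (+ 2 ℤ.* P ℤ.+ R) ℤ.* (Q ℤ.+ + 2 ℤ.* S)
      ≡⟨ solve 4 (λ P Q R S → (con (+ 2) :* Q :+ S) :* (P :+ con (+ 2) :* R)
                              :- (con (+ 2) :* P :+ R) :* (Q :+ con (+ 2) :* S)
                            := con (+ 3) :* (Q :* R :- P :* S)) refl P Q R S ⟩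
    + 3 ℤ.* (Q ℤ.* R ℤ.- P ℤ.* S)
      ≡⟨ cong (+ 3 ℤ.*_) (det-cast p q r s) ⟨
    + 3 ℤ.* det (p , q) (r , s) ∎

left≡leftᵘ : ∀ x y → det x y ≡ + 1 → left x y ≡ leftᵘ x y
left≡leftᵘ (p , q) (r , s) eq =
  reduce-coprime (det≡1⇒coprimeʳ (p , q) (trans (det-leftᵘ p q r s) eq))

right≡rightᵘ : ∀ x y → det x y ≡ + 1 → right x y ≡ rightᵘ x y
right≡rightᵘ (p , q) (r , s) eq =
  reduce-coprime (det≡1⇒coprimeˡ (r , s) (trans (det-rightᵘ p q r s) eq))

-- Indexed by i * 3 rather than 3 * i because suc i * 3 unfolds to 3 + i * 3.
nth-step : ∀ L i {x y} → nth L i ≡ just x → nth L (suc i) ≡ just y →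
  nth (step L) (i * 3) ≡ just x × nth (step L) (suc (i * 3)) ≡ just (left x y) ×
  nth (step L) (suc (suc (i * 3))) ≡ just (right x y) ×
  nth (step L) (suc (suc (suc (i * 3)))) ≡ just y
nth-step (a ∷ b ∷ L) zero    refl refl = refl , refl , refl , nth-step-head b L
  where
  nth-step-head : ∀ b L → nth (step (b ∷ L)) 0 ≡ just b
  nth-step-head b []      = refl
  nth-step-head b (_ ∷ _) = refl
nth-step (a ∷ b ∷ L) (suc i) xᵢ yᵢ = nth-step (b ∷ L) i xᵢ yᵢ

C≡just⇒adjacent : ∀ n i {z} → C n i ≡ just z →
  ∃₂ λ x y → nth (SB n) i ≡ just x × nth (SB n) (suc i) ≡ just y × det x y ≡ z
C≡just⇒adjacent n i eq with nth (SB n) i | nth (SB n) (suc i)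
C≡just⇒adjacent n i refl | just x | just y = x , y , refl , refl , refl

adjacent⇒C≡just : ∀ n i {x y z} → nth (SB n) i ≡ just x → nth (SB n) (suc i) ≡ just y →
  det x y ≡ z → C n i ≡ just z
adjacent⇒C≡just n i xᵢ yᵢ refl rewrite xᵢ | yᵢ = refl

lemma12 : (n i : ℕ) → i < 3 ^ n → C n i ≡ just (+ 1) →
    (C (suc n) (3 * i) ≡ just (+ 1)) × (C (suc n) (3 * i + 1) ≡ just (+ 3)) × (C (suc n) (3 * i + 2) ≡ just (+ 1))
lemma12 n i _ Cᵢ≡1 with C≡just⇒adjacent n i Cᵢ≡1
... | (p , q) , (r , s) , xᵢ , yᵢ , det≡1 with nth-step (SB n) i xᵢ yᵢ
... | x₀ , l₁ , r₂ , y₃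
  rewrite ℕ.*-comm 3 i | ℕ.+-comm (i * 3) 1 | ℕ.+-comm (i * 3) 2
        | left≡leftᵘ (p , q) (r , s) det≡1 | right≡rightᵘ (p , q) (r , s) det≡1 =
    adjacent⇒C≡just (suc n) (i * 3) x₀ l₁ (trans (det-leftᵘ p q r s) det≡1)
  , adjacent⇒C≡just (suc n) (suc (i * 3)) l₁ r₂ (trans (det-leftᵘ-rightᵘ p q r s) (cong (+ 3 ℤ.*_) det≡1))
  , adjacent⇒C≡just (suc n) (suc (suc (i * 3))) r₂ y₃ (trans (det-rightᵘ p q r s) det≡1)
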